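{- Let $V\in M_{r\times t}(\mathbb{Z})$ with $t\ge2$ and rows $L_1,\dots,L_r$, and let $\psi=(\psi_1,\dots,\psi_t):\mathbb{Q}^d\twoheadrightarrow\ker(V)\subset\mathbb{Q}^t$ be a surjective system of linear forms. Let $i\in[t]$ and $s_0\ge 0$. Then $\psi$ has complexity at most $s_0$ at $i$ if and only if there exist an integer $0\le s\le s_0$ and a partition $[t]\setminus\{i\}=X_1\sqcup\dots\sqcup X_{s+1}$ into non-empty sets such that, for every $k\in[s+1]$, $$\Big(e_i+\sum_{j\in X_k}\mathbb{Q}e_j\Big)\cap\big\langle L_1^{T},\dots,L_r^{T}\big\rangle=\varnothing,$$ where $(e_j)_{1\le j\le t}$ is the canonical basis of $\mathbb{Q}^t$ and $\langle\cdot\rangle$ denotes the $\mathbb{Q}$-linear span.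
   Context: For a system of linear forms $\psi=(\psi_1,\dots,\psi_t):\mathbb{Q}^d\to\mathbb{Q}^t$ and $i\in[t]$, the complexity of $\psi$ at $i$ is the least integer $s\ge0$ such that $[t]\setminus\{i\}$ can be partitioned into $s+1$ non-empty sets $X_1,\dots,X_{s+1}$ with $\psi_i\notin\langle\psi_j:j\in X_k\rangle$ for all $k\in[s+1]$; it is $\infty$ if no such $s$ exists. -}

module Defs where

open import Data.Nat using (ℕ; zero; suc; _≤_)
open import Data.Fin using (Fin; zero; suc)
open import Data.Integer using (ℤ)
open import Data.Rational using (ℚ; 0ℚ; 1ℚ; _+_; _*_; _/_)
open import Data.Product using (Σ; ∃; _×_; _,_)
open import Relation.Binary.PropositionalEquality using (_≡_; _≢_)
open import Relation.Nullary using (¬_; yes; no)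
open import Data.Fin using (_≟_)

∑ : ∀ {n} → (Fin n → ℚ) → ℚ
∑ {zero}  f = 0ℚ
∑ {suc n} f = f zero + ∑ (λ j → f (suc j))

toℚ : ℤ → ℚ
toℚ z = z / 1

e : ∀ {t} → Fin t → Fin t → ℚ
e i j with i ≟ j
... | yes _ = 1ℚ
... | no  _ = 0ℚ

-- A linear form on ℚ^d is given by its coefficient vector: φ(x) = Σ_m φ m * x m.
LinForm : ℕ → Set
LinForm d = Fin d → ℚ

eval : ∀ {d} → LinForm d → (Fin d → ℚ) → ℚ
eval φ x = ∑ (λ m → φ m * x m)

System : ℕ → ℕ → Set
System d t = Fin t → LinForm d

apply : ∀ {d t} → System d t → (Fin d → ℚ) → Fin t → ℚ
apply ψ x j = eval (ψ j) x

InKer : ∀ {r t} → (Fin r → Fin t → ℤ) → (Fin t → ℚ) → Set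
InKer V y = ∀ l → ∑ (λ j → toℚ (V l j) * y j) ≡ 0ℚ

SurjOntoKer : ∀ {d r t} → System d t → (Fin r → Fin t → ℤ) → Set
SurjOntoKer {d} ψ V =
  (∀ x → InKer V (apply ψ x)) ×
  (∀ y → InKer V y → Σ (Fin d → ℚ) λ x → ∀ j → apply ψ x j ≡ y j)

-- A partition of [t] \ {i} into s+1 non-empty labelled blocks X_1,…,X_{s+1}:
-- given by a block assignment c (the value at i is irrelevant);
-- X_k = { j | j ≢ i and c j ≡ k }.
InBlock : ∀ {t s} → Fin t → (Fin t → Fin (suc s)) → Fin (suc s) → Fin t → Set
InBlock i c k j = (j ≢ i) × (c j ≡ k)

IsPartition : ∀ {t} (s : ℕ) → Fin t → (Fin t → Fin (suc s)) → Set
IsPartition {t} s i c = ∀ (k : Fin (suc s)) → Σ (Fin t) λ j → InBlock i c k j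

InSpanForms : ∀ {d t} → System d t → Fin t → (Fin t → Set) → Set
InSpanForms {d} {t} ψ i X =
  Σ (Fin t → ℚ) λ λ' →
    (∀ j → ¬ X j → λ' j ≡ 0ℚ) ×
    (∀ m → ψ i m ≡ ∑ (λ j → λ' j * ψ j m))

ComplexityWitness : ∀ {d t} → System d t → Fin t → ℕ → Set
ComplexityWitness {d} {t} ψ i s =
  Σ (Fin t → Fin (suc s)) λ c →
    IsPartition s i c ×
    (∀ k → ¬ InSpanForms ψ i (InBlock i c k))

-- ψ has complexity at most s₀ at i: the least s with a witness exists and is ≤ s₀,
-- i.e. some s ≤ s₀ admits a witness.
ComplexityAtMost : ∀ {d t} → System d t → Fin t → ℕ → Set
ComplexityAtMost ψ i s₀ = Σ ℕ λ s → (s ≤ s₀) × ComplexityWitness ψ i s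

AffineMissesRowSpan : ∀ {r t} → (Fin r → Fin t → ℤ) → Fin t → (Fin t → Set) → Set
AffineMissesRowSpan {r} {t} V i X =
  ¬ (Σ (Fin t → ℚ) λ a → Σ (Fin r → ℚ) λ μ →
       (∀ j → ¬ X j → a j ≡ 0ℚ) ×
       (∀ m → ∑ (λ l → μ l * toℚ (V l m)) ≡ e i m + a m))

-- ψ_i lies in the span of (ψ_j)_{j ∈ X} exactly when some vector e_i + a with a supported on X
-- is a linear relation among the forms ψ_j, i.e. is orthogonal to the image of ψ, which is ker V.
-- The vectors orthogonal to ker V are exactly those of the row space of V (the nontrivial
-- inclusion by Gaussian elimination on the rows of V), so for every block X_k the span condition
-- of the complexity and the condition on the affine space e_i + Σ_{j ∈ X_k} ℚ e_j are negations
-- of each other.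

module Submission where

open import Defs
open import Data.Nat using (ℕ; zero; suc; _≤_)
open import Data.Fin using (Fin; zero; suc; punchIn) renaming (_≟_ to _≟ᶠ_)
open import Data.Fin.Properties using (all?; ¬∀⟶∃¬; punchInᵢ≢i)
open import Data.Integer using (ℤ)
open import Data.Rational using (ℚ; 0ℚ; 1ℚ; _+_; _*_; _-_; -_; 1/_; NonZero; ≢-nonZero)
open import Data.Rational.Properties
  using (_≟_; +-*-commutativeRing; +-0-group; *-comm; *-assoc; *-zeroˡ; *-zeroʳ; *-inverseʳ;
         *-distribʳ-+; +-identityˡ; +-inverseʳ; neg-distrib-+; neg-distribˡ-*)
open import Data.Rational.Solver using (module +-*-Solver)
open import Algebra.Bundles using (CommutativeRing)
import Algebra.Properties.Semiring.Sum (CommutativeRing.semiring +-*-commutativeRing) as Sum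
open import Algebra.Properties.Group +-0-group using (inverseˡ-unique)
open import Data.Vec.Functional using (Vector; _∷_; tail)
open import Data.Product using (Σ; ∃; _×_; _,_)
open import Data.Sum using (_⊎_; inj₁; inj₂)
open import Function using (_∘_; _⇔_; mk⇔; Equivalence)
open import Relation.Binary.PropositionalEquality
  using (_≡_; _≢_; refl; sym; trans; cong; cong₂; module ≡-Reasoning)
open import Relation.Nullary using (¬_; yes; no; contradiction)

open +-*-Solver using (solve; _:+_; _:*_; _:-_; _:=_; con)
open ≡-Reasoning

∑≡sum : ∀ {n} (f : Vector ℚ n) → ∑ f ≡ Sum.sum f
∑≡sum {zero}  f = refl
∑≡sum {suc n} f = cong (f zero +_) (∑≡sum (tail f))

∑-cong : ∀ {n} {f g : Vector ℚ n} → (∀ j → f j ≡ g j) → ∑ f ≡ ∑ g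
∑-cong {f = f} {g} f≗g = trans (∑≡sum f) (trans (Sum.sum-cong-≗ f≗g) (sym (∑≡sum g)))

∑-zero : ∀ n → ∑ {n} (λ _ → 0ℚ) ≡ 0ℚ
∑-zero n = trans (∑≡sum {n} (λ _ → 0ℚ)) (Sum.sum-replicate-zero n)

∑-distrib-+ : ∀ {n} (f g : Vector ℚ n) → ∑ (λ j → f j + g j) ≡ ∑ f + ∑ g
∑-distrib-+ f g = begin
  ∑ (λ j → f j + g j)      ≡⟨ ∑≡sum (λ j → f j + g j) ⟩
  Sum.sum (λ j → f j + g j) ≡⟨ Sum.∑-distrib-+ f g ⟩
  Sum.sum f + Sum.sum g    ≡⟨ cong₂ _+_ (∑≡sum f) (∑≡sum g) ⟨
  ∑ f + ∑ g                ∎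

*-distribˡ-∑ : ∀ {n} (c : ℚ) (f : Vector ℚ n) → c * ∑ f ≡ ∑ (λ j → c * f j)
*-distribˡ-∑ c f = begin
  c * ∑ f                   ≡⟨ cong (c *_) (∑≡sum f) ⟩
  c * Sum.sum f             ≡⟨ Sum.*-distribˡ-sum c f ⟩
  Sum.sum (λ j → c * f j)   ≡⟨ ∑≡sum (λ j → c * f j) ⟨
  ∑ (λ j → c * f j)         ∎

*-distribʳ-∑ : ∀ {n} (c : ℚ) (f : Vector ℚ n) → ∑ f * c ≡ ∑ (λ j → f j * c)
*-distribʳ-∑ c f = begin
  ∑ f * c                   ≡⟨ cong (_* c) (∑≡sum f) ⟩
  Sum.sum f * c             ≡⟨ Sum.*-distribʳ-sum c f ⟩
  Sum.sum (λ j → f j * c)   ≡⟨ ∑≡sum (λ j → f j * c) ⟨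
  ∑ (λ j → f j * c)         ∎

∑-comm : ∀ {m n} (f : Fin m → Fin n → ℚ) → ∑ (λ i → ∑ (f i)) ≡ ∑ (λ j → ∑ (λ i → f i j))
∑-comm f = begin
  ∑ (λ i → ∑ (f i))                   ≡⟨ ∑∑≡sum-sum f ⟩
  Sum.sum (λ i → Sum.sum (f i))       ≡⟨ Sum.∑-comm f ⟩
  Sum.sum (λ j → Sum.sum (λ i → f i j)) ≡⟨ ∑∑≡sum-sum (λ j i → f i j) ⟨
  ∑ (λ j → ∑ (λ i → f i j))           ∎
  where
  ∑∑≡sum-sum : ∀ {m n} (g : Fin m → Fin n → ℚ) → ∑ (λ i → ∑ (g i)) ≡ Sum.sum (λ i → Sum.sum (g i))
  ∑∑≡sum-sum g = trans (∑≡sum (λ i → ∑ (g i))) (Sum.sum-cong-≗ (λ i → ∑≡sum (g i)))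

neg-distrib-∑ : ∀ {n} (f : Vector ℚ n) → - ∑ f ≡ ∑ (λ j → - f j)
neg-distrib-∑ {zero}  f = refl
neg-distrib-∑ {suc n} f = trans (neg-distrib-+ (f zero) _) (cong (- f zero +_) (neg-distrib-∑ (tail f)))

∑-sub-scaled : ∀ {n} (f g : Vector ℚ n) (c : ℚ) → ∑ (λ j → f j - c * g j) ≡ ∑ f - c * ∑ g
∑-sub-scaled f g c = begin
  ∑ (λ j → f j - c * g j)       ≡⟨ ∑-cong (λ j → cong (f j +_) (neg-distribˡ-* c (g j))) ⟩
  ∑ (λ j → f j + - c * g j)     ≡⟨ ∑-distrib-+ f _ ⟩
  ∑ f + ∑ (λ j → - c * g j)     ≡⟨ cong (∑ f +_) (*-distribˡ-∑ (- c) g) ⟨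
  ∑ f + - c * ∑ g               ≡⟨ cong (∑ f +_) (neg-distribˡ-* c (∑ g)) ⟨
  ∑ f - c * ∑ g                 ∎

infix 9 _·_

_·_ : ∀ {n} → Vector ℚ n → Vector ℚ n → ℚ
u · y = ∑ (λ j → u j * y j)

·-comm : ∀ {n} (u y : Vector ℚ n) → u · y ≡ y · u
·-comm u y = ∑-cong (λ j → *-comm (u j) (y j))

·-congˡ : ∀ {n} {u v : Vector ℚ n} (y : Vector ℚ n) → (∀ j → u j ≡ v j) → u · y ≡ v · y
·-congˡ y u≗v = ∑-cong (λ j → cong (_* y j) (u≗v j))

·-congʳ : ∀ {n} (u : Vector ℚ n) {y z : Vector ℚ n} → (∀ j → y j ≡ z j) → u · y ≡ u · z
·-congʳ u y≗z = ∑-cong (λ j → cong (u j *_) (y≗z j))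

·-zeroˡ : ∀ {n} {u : Vector ℚ n} (y : Vector ℚ n) → (∀ j → u j ≡ 0ℚ) → u · y ≡ 0ℚ
·-zeroˡ {n} y u≗0 = trans (∑-cong (λ j → trans (cong (_* y j) (u≗0 j)) (*-zeroˡ (y j)))) (∑-zero n)

·-zeroʳ : ∀ {n} (u : Vector ℚ n) {y : Vector ℚ n} → (∀ j → y j ≡ 0ℚ) → u · y ≡ 0ℚ
·-zeroʳ u {y} y≗0 = trans (·-comm u y) (·-zeroˡ u y≗0)

·-linearˡ : ∀ {n} (u v y : Vector ℚ n) (c : ℚ) → (λ j → u j - c * v j) · y ≡ u · y - c * v · y
·-linearˡ u v y c = trans
  (∑-cong (λ j → solve 4 (λ u v y c → (u :- c :* v) :* y := u :* y :- c :* (v :* y)) refl (u j) (v j) (y j) c))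
  (∑-sub-scaled (λ j → u j * y j) (λ j → v j * y j) c)

·-linearʳ : ∀ {n} (u y v : Vector ℚ n) (c : ℚ) → u · (λ j → y j - c * v j) ≡ u · y - c * u · v
·-linearʳ u y v c = trans
  (∑-cong (λ j → solve 4 (λ u y v c → u :* (y :- c :* v) := u :* y :- c :* (u :* v)) refl (u j) (y j) (v j) c))
  (∑-sub-scaled (λ j → u j * y j) (λ j → u j * v j) c)

e-diag : ∀ {t} (p : Fin t) → e p p ≡ 1ℚ
e-diag p with p ≟ᶠ p
... | yes _   = refl
... | no p≢p = contradiction refl p≢p

e-offDiag : ∀ {t} {p j : Fin t} → p ≢ j → e p j ≡ 0ℚ
e-offDiag {p = p} {j} p≢j with p ≟ᶠ j
... | yes p≡j = contradiction p≡j p≢j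
... | no _    = refl

·-e : ∀ {t} (u : Vector ℚ t) (p : Fin t) → u · e p ≡ u p
·-e {suc t} u p = begin
  u · e p                                                        ≡⟨ ∑≡sum (λ j → u j * e p j) ⟩
  Sum.sum (λ j → u j * e p j)                                    ≡⟨ Sum.sum-remove {i = p} (λ j → u j * e p j) ⟩
  u p * e p p + Sum.sum (λ j → u (punchIn p j) * e p (punchIn p j)) ≡⟨ cong₂ _+_ (cong (u p *_) (e-diag p)) others ⟩
  u p * 1ℚ + 0ℚ                                                  ≡⟨ solve 1 (λ x → x :* con 1ℚ :+ con 0ℚ := x) refl (u p) ⟩
  u p                                                            ∎
  where
  others : Sum.sum (λ j → u (punchIn p j) * e p (punchIn p j)) ≡ 0ℚ
  others = trans
    (Sum.sum-cong-≗ (λ j → trans (cong (u (punchIn p j) *_) (e-offDiag (punchInᵢ≢i p j ∘ sym))) (*-zeroʳ (u (punchIn p j)))))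
    (Sum.sum-replicate-zero t)

e-· : ∀ {t} (p : Fin t) (u : Vector ℚ t) → e p · u ≡ u p
e-· p u = trans (·-comm (e p) u) (·-e u p)

lincomb : ∀ {r t} → Vector ℚ r → (Fin r → Vector ℚ t) → Vector ℚ t
lincomb μ A m = ∑ (λ l → μ l * A l m)

lincomb-· : ∀ {r t} (μ : Vector ℚ r) (A : Fin r → Vector ℚ t) (y : Vector ℚ t) →
            lincomb μ A · y ≡ μ · (λ l → A l · y)
lincomb-· μ A y = begin
  ∑ (λ j → ∑ (λ l → μ l * A l j) * y j)   ≡⟨ ∑-cong (λ j → *-distribʳ-∑ (y j) (λ l → μ l * A l j)) ⟩
  ∑ (λ j → ∑ (λ l → μ l * A l j * y j))   ≡⟨ ∑-comm (λ j l → μ l * A l j * y j) ⟩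
  ∑ (λ l → ∑ (λ j → μ l * A l j * y j))   ≡⟨ ∑-cong (λ l → ∑-cong (λ j → *-assoc (μ l) (A l j) (y j))) ⟩
  ∑ (λ l → ∑ (λ j → μ l * (A l j * y j))) ≡⟨ ∑-cong (λ l → *-distribˡ-∑ (μ l) (λ j → A l j * y j)) ⟨
  ∑ (λ l → μ l * ∑ (λ j → A l j * y j))   ∎

lincomb-e+ : ∀ {r t} (i : Fin r) (a : Vector ℚ r) (A : Fin r → Vector ℚ t) (m : Fin t) →
             lincomb (λ j → e i j + a j) A m ≡ A i m + lincomb a A m
lincomb-e+ i a A m = begin
  ∑ (λ j → (e i j + a j) * A j m)         ≡⟨ ∑-cong (λ j → *-distribʳ-+ (A j m) (e i j) (a j)) ⟩
  ∑ (λ j → e i j * A j m + a j * A j m)   ≡⟨ ∑-distrib-+ (λ j → e i j * A j m) (λ j → a j * A j m) ⟩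
  e i · (λ j → A j m) + lincomb a A m     ≡⟨ cong (_+ lincomb a A m) (e-· i _) ⟩
  A i m + lincomb a A m                   ∎

lincomb-neg : ∀ {r t} (a : Vector ℚ r) (A : Fin r → Vector ℚ t) (m : Fin t) →
              lincomb (λ j → - a j) A m ≡ - lincomb a A m
lincomb-neg a A m = trans (∑-cong (λ j → sym (neg-distribˡ-* (a j) (A j m)))) (sym (neg-distrib-∑ (λ j → a j * A j m)))

Kernel : ∀ {r t} → (Fin r → Vector ℚ t) → Vector ℚ t → Set
Kernel A y = ∀ k → A k · y ≡ 0ℚ

RowSpan : ∀ {r t} → (Fin r → Vector ℚ t) → Vector ℚ t → Set
RowSpan {r} A w = Σ (Vector ℚ r) λ μ → ∀ m → lincomb μ A m ≡ w m

AnnihilatesKernel : ∀ {r t} → (Fin r → Vector ℚ t) → Vector ℚ t → Set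
AnnihilatesKernel A w = ∀ y → Kernel A y → w · y ≡ 0ℚ

rowSpan⇒annihilatesKernel : ∀ {r t} (A : Fin r → Vector ℚ t) (w : Vector ℚ t) →
                            RowSpan A w → AnnihilatesKernel A w
rowSpan⇒annihilatesKernel A w (μ , μA≗w) y y∈ker = begin
  w · y                ≡⟨ ·-congˡ y μA≗w ⟨
  lincomb μ A · y      ≡⟨ lincomb-· μ A y ⟩
  μ · (λ l → A l · y)  ≡⟨ ·-zeroʳ μ y∈ker ⟩
  0ℚ                   ∎

annihilatesKernel-tail : ∀ {r t} (A : Fin (suc r) → Vector ℚ t) (w : Vector ℚ t) →
                         (∀ j → A zero j ≡ 0ℚ) → AnnihilatesKernel A w → AnnihilatesKernel (tail A) w
annihilatesKernel-tail A w A₀≗0 ann y y∈ker = ann y λ { zero → ·-zeroˡ y A₀≗0 ; (suc k) → y∈ker k }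

rowSpan-tail : ∀ {r t} (A : Fin (suc r) → Vector ℚ t) (w : Vector ℚ t) → RowSpan (tail A) w → RowSpan A w
rowSpan-tail A w (μ , μA≗w) = (0ℚ ∷ μ) , λ m →
  trans (cong (_+ lincomb μ (tail A) m) (*-zeroˡ (A zero m))) (trans (+-identityˡ _) (μA≗w m))

rowSpan-unshift : ∀ {r t} (A : Fin (suc r) → Vector ℚ t) (α : Vector ℚ r) (β : ℚ) (w : Vector ℚ t) →
                  RowSpan (λ k j → A (suc k) j - α k * A zero j) (λ j → w j - β * A zero j) → RowSpan A w
rowSpan-unshift A α β w (μ , eq) = ((β - μ · α) ∷ μ) , λ m → begin
  (β - μ · α) * A zero m + lincomb μ (tail A) m
    ≡⟨ solve 4 (λ b s a c → (b :- s) :* a :+ c := (c :- a :* s) :+ b :* a) refl β (μ · α) (A zero m) _ ⟩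
  (lincomb μ (tail A) m - A zero m * μ · α) + β * A zero m
    ≡⟨ cong (_+ β * A zero m) (trans (unshifted m) (eq m)) ⟩
  (w m - β * A zero m) + β * A zero m
    ≡⟨ solve 2 (λ w c → (w :- c) :+ c := w) refl (w m) (β * A zero m) ⟩
  w m ∎
  where
  unshifted : ∀ m → lincomb μ (tail A) m - A zero m * μ · α ≡ lincomb μ (λ k j → A (suc k) j - α k * A zero j) m
  unshifted m = sym (trans
    (∑-cong (λ l → solve 4 (λ u b c a → u :* (b :- c :* a) := u :* b :- a :* (u :* c)) refl
                          (μ l) (A (suc l) m) (α l) (A zero m)))
    (∑-sub-scaled (λ l → μ l * A (suc l) m) (λ l → μ l * α l) (A zero m)))

module Pivot {r t} (A : Fin (suc r) → Vector ℚ t) (p : Fin t) (A₀p≢0 : A zero p ≢ 0ℚ) where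

  private
    instance
      A₀p-nonZero : NonZero (A zero p)
      A₀p-nonZero = ≢-nonZero A₀p≢0

  multiplier : Vector ℚ t → ℚ
  multiplier u = u p * 1/ A zero p

  eliminate : Vector ℚ t → Vector ℚ t
  eliminate u j = u j - multiplier u * A zero j

  eliminateᵀ : Vector ℚ t → Vector ℚ t
  eliminateᵀ y j = y j - A zero · y * 1/ A zero p * e p j

  eliminate-pivotRow : ∀ j → eliminate (A zero) j ≡ 0ℚ
  eliminate-pivotRow j = begin
    A zero j - A zero p * 1/ A zero p * A zero j ≡⟨ cong (λ c → A zero j - c * A zero j) (*-inverseʳ (A zero p)) ⟩
    A zero j - 1ℚ * A zero j                    ≡⟨ solve 1 (λ a → a :- con 1ℚ :* a := con 0ℚ) refl (A zero j) ⟩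
    0ℚ                                          ∎

  ·-eliminateᵀ : ∀ u y → u · eliminateᵀ y ≡ eliminate u · y
  ·-eliminateᵀ u y = begin
    u · eliminateᵀ y                                ≡⟨ ·-linearʳ u y (e p) (A zero · y * 1/ A zero p) ⟩
    u · y - A zero · y * 1/ A zero p * u · e p      ≡⟨ cong (λ x → u · y - A zero · y * 1/ A zero p * x) (·-e u p) ⟩
    u · y - A zero · y * 1/ A zero p * u p
      ≡⟨ solve 4 (λ uy πy i up → uy :- πy :* i :* up := uy :- up :* i :* πy) refl (u · y) (A zero · y) (1/ A zero p) (u p) ⟩
    u · y - multiplier u * A zero · y               ≡⟨ ·-linearˡ u (A zero) y (multiplier u) ⟨
    eliminate u · y                                 ∎

  annihilatesKernel-eliminate : ∀ w → AnnihilatesKernel A w → AnnihilatesKernel (eliminate ∘ tail A) (eliminate w)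
  annihilatesKernel-eliminate w ann y y∈ker = begin
    eliminate w · y    ≡⟨ ·-eliminateᵀ w y ⟨
    w · eliminateᵀ y   ≡⟨ ann (eliminateᵀ y) eliminateᵀy∈ker ⟩
    0ℚ                 ∎
    where
    eliminateᵀy∈ker : Kernel A (eliminateᵀ y)
    eliminateᵀy∈ker zero    = trans (·-eliminateᵀ (A zero) y) (·-zeroˡ y eliminate-pivotRow)
    eliminateᵀy∈ker (suc k) = trans (·-eliminateᵀ (A (suc k)) y) (y∈ker k)

  rowSpan-uneliminate : ∀ w → RowSpan (eliminate ∘ tail A) (eliminate w) → RowSpan A w
  rowSpan-uneliminate w = rowSpan-unshift A (multiplier ∘ tail A) (multiplier w) w

zero⊎pivot : ∀ {t} (u : Vector ℚ t) → (∀ j → u j ≡ 0ℚ) ⊎ ∃ λ p → u p ≢ 0ℚ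
zero⊎pivot {t} u with all? (λ j → u j ≟ 0ℚ)
... | yes u≗0 = inj₁ u≗0
... | no u≢0  = inj₂ (¬∀⟶∃¬ t _ (λ j → u j ≟ 0ℚ) u≢0)

annihilatesKernel⇒rowSpan : ∀ {r t} (A : Fin r → Vector ℚ t) (w : Vector ℚ t) →
                            AnnihilatesKernel A w → RowSpan A w
annihilatesKernel⇒rowSpan {zero} A w ann = (λ ()) , λ m → sym (trans (sym (·-e w m)) (ann (e m) λ ()))
annihilatesKernel⇒rowSpan {suc r} A w ann with zero⊎pivot (A zero)
... | inj₁ A₀≗0 =
  rowSpan-tail A w (annihilatesKernel⇒rowSpan (tail A) w (annihilatesKernel-tail A w A₀≗0 ann))
... | inj₂ (p , A₀p≢0) =
  rowSpan-uneliminate w (annihilatesKernel⇒rowSpan (eliminate ∘ tail A) (eliminate w) (annihilatesKernel-eliminate w ann))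
  where open Pivot A p A₀p≢0

toℚᴹ : ∀ {r t} → (Fin r → Fin t → ℤ) → Fin r → Vector ℚ t
toℚᴹ V l j = toℚ (V l j)

IsLinearRelation : ∀ {d t} → System d t → Vector ℚ t → Set
IsLinearRelation ψ w = ∀ m → lincomb w ψ m ≡ 0ℚ

Supported : ∀ {t} → (Fin t → Set) → Vector ℚ t → Set
Supported X a = ∀ j → ¬ X j → a j ≡ 0ℚ

relation-annihilates-image : ∀ {d t} (ψ : System d t) (w : Vector ℚ t) →
                             IsLinearRelation ψ w → ∀ x → w · apply ψ x ≡ 0ℚ
relation-annihilates-image ψ w rel x = trans (sym (lincomb-· w ψ x)) (·-zeroˡ x rel)

relation⇔rowSpan : ∀ {d r t} (ψ : System d t) (V : Fin r → Fin t → ℤ) → SurjOntoKer ψ V →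
                   ∀ w → IsLinearRelation ψ w ⇔ RowSpan (toℚᴹ V) w
relation⇔rowSpan ψ V (image⊆ker , ker⊆image) w = mk⇔ to from
  where
  to : IsLinearRelation ψ w → RowSpan (toℚᴹ V) w
  to rel = annihilatesKernel⇒rowSpan (toℚᴹ V) w λ y y∈ker →
    let (x , ψx≗y) = ker⊆image y y∈ker
    in trans (·-congʳ w (λ j → sym (ψx≗y j))) (relation-annihilates-image ψ w rel x)

  from : RowSpan (toℚᴹ V) w → IsLinearRelation ψ w
  from w∈span m = begin
    lincomb w ψ m      ≡⟨ ·-congʳ w (λ j → ·-e (ψ j) m) ⟨
    w · apply ψ (e m)  ≡⟨ rowSpan⇒annihilatesKernel (toℚᴹ V) w w∈span _ (image⊆ker (e m)) ⟩
    0ℚ                 ∎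

inSpanForms⇔relation : ∀ {d t} (ψ : System d t) (i : Fin t) (X : Fin t → Set) →
                       InSpanForms ψ i X ⇔ Σ (Vector ℚ t) λ a → Supported X a × IsLinearRelation ψ (λ j → e i j + a j)
inSpanForms⇔relation {t = t} ψ i X = mk⇔ to from
  where
  to : InSpanForms ψ i X → Σ (Vector ℚ t) λ a → Supported X a × IsLinearRelation ψ (λ j → e i j + a j)
  to (λ′ , supp , ψᵢ≡) = (λ j → - λ′ j) , (λ j j∉X → cong -_ (supp j j∉X)) , λ m → begin
    lincomb (λ j → e i j - λ′ j) ψ m   ≡⟨ lincomb-e+ i _ ψ m ⟩
    ψ i m + lincomb (λ j → - λ′ j) ψ m ≡⟨ cong₂ _+_ (ψᵢ≡ m) (lincomb-neg λ′ ψ m) ⟩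
    lincomb λ′ ψ m - lincomb λ′ ψ m    ≡⟨ +-inverseʳ (lincomb λ′ ψ m) ⟩
    0ℚ                                 ∎

  from : (Σ (Vector ℚ t) λ a → Supported X a × IsLinearRelation ψ (λ j → e i j + a j)) → InSpanForms ψ i X
  from (a , supp , rel) = (λ j → - a j) , (λ j j∉X → cong -_ (supp j j∉X)) , λ m → begin
    ψ i m                       ≡⟨ inverseˡ-unique (ψ i m) _ (trans (sym (lincomb-e+ i a ψ m)) (rel m)) ⟩
    - lincomb a ψ m             ≡⟨ lincomb-neg a ψ m ⟨
    lincomb (λ j → - a j) ψ m   ∎

¬inSpanForms⇔affineMissesRowSpan : ∀ {d r t} (ψ : System d t) (V : Fin r → Fin t → ℤ) → SurjOntoKer ψ V →
                                   ∀ i X → (¬ InSpanForms ψ i X) ⇔ AffineMissesRowSpan V i X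
¬inSpanForms⇔affineMissesRowSpan {t = t} ψ V surj i X = mk⇔
  (λ ¬span (a , μ , supp , eq) →
     ¬span (Equivalence.from span⇔relation (a , supp , Equivalence.from (rowSpan a) (μ , eq))))
  (λ misses span →
     let (a , supp , rel) = Equivalence.to span⇔relation span
         (μ , eq)         = Equivalence.to (rowSpan a) rel
     in misses (a , μ , supp , eq))
  where
  span⇔relation : InSpanForms ψ i X ⇔ Σ (Vector ℚ t) λ a → Supported X a × IsLinearRelation ψ (λ j → e i j + a j)
  span⇔relation = inSpanForms⇔relation ψ i X

  rowSpan : ∀ a → IsLinearRelation ψ (λ j → e i j + a j) ⇔ RowSpan (toℚᴹ V) (λ j → e i j + a j)
  rowSpan a = relation⇔rowSpan ψ V surj (λ j → e i j + a j)

proposition4p7 : (r t d : ℕ) → 2 ≤ t → (V : Fin r → Fin t → ℤ) → (ψ : System d t) → SurjOntoKer ψ V → (i : Fin t) → (s₀ : ℕ) →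
    ComplexityAtMost ψ i s₀ ⇔
      (Σ ℕ λ s → (s ≤ s₀) × Σ (Fin t → Fin (suc s)) λ c → IsPartition s i c × (∀ k → AffineMissesRowSpan V i (InBlock i c k)))
proposition4p7 r t d _ V ψ surj i s₀ = mk⇔
  (λ (s , s≤s₀ , c , partition , ¬span) →
     s , s≤s₀ , c , partition , λ k → Equivalence.to (blockwise c k) (¬span k))
  (λ (s , s≤s₀ , c , partition , misses) →
     s , s≤s₀ , c , partition , λ k → Equivalence.from (blockwise c k) (misses k))
  where
  blockwise : ∀ {s} (c : Fin t → Fin (suc s)) (k : Fin (suc s)) →
              (¬ InSpanForms ψ i (InBlock i c k)) ⇔ AffineMissesRowSpan V i (InBlock i c k)
  blockwise c k = ¬inSpanForms⇔affineMissesRowSpan ψ V surj i (InBlock i c k)
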